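{- Let $n\ge1$ and $k\ge1$. Let $\mathfrak{d}=\mathfrak{d}_1\circ\mathfrak{d}_2\circ\cdots\circ\mathfrak{d}_n$ and $\mathfrak{f}=\mathfrak{f}_1\circ\mathfrak{f}_2\circ\cdots\circ\mathfrak{f}_n$, where all the $\mathfrak{d}_i$ and $\mathfrak{f}_i$ are (not necessarily indecomposable) splitted bipartite degree sequences on the same number $k+k$ of vertices. If $\mathfrak{d}_i\ne\mathfrak{f}_i$ for some $i$, then $\mathfrak{d}\ne\mathfrak{f}$.
   Context: A splitted bipartite degree sequence $\langle\mathfrak{u},\mathfrak{w}\rangle$ is the degree sequence of a bipartite graph with designated primary class (degrees $\mathfrak{u}$) and secondary class (degrees $\mathfrak{w}$); $k+k$ vertices means $k$ primary and $k$ secondary vertices. Composition is defined by $\langle\mathfrak{u},\mathfrak{w}\rangle\circ\langle\mathfrak{x},\mathfrak{y}\rangle=\langle(\mathfrak{u}\oplus|\mathfrak{y}|,\ \mathfrak{x}),\ (\mathfrak{w},\ \mathfrak{y}\oplus|\mathfrak{u}|)\rangle$, where $\oplus c$ adds $c$ to every entry and $|\cdot|$ is the length. This corresponds to composing splitted bipartite graphs $(\langle\mathfrak{U},\mathfrak{W}\rangle;\mathfrak{E})\circ(\langle\mathfrak{X},\mathfrak{Y}\rangle;\mathfrak{F})=(\langle\mathfrak{U}\cup\mathfrak{X},\mathfrak{W}\cup\mathfrak{Y}\rangle;\mathfrak{E}\cup\mathfrak{F}\cup E(K_{\mathfrak{U},\mathfrak{Y}}))$. Composition is associative. A splitted bipartite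 degree sequence is indecomposable if it is not the composition of two splitted bipartite degree sequences each with at least one vertex. Every splitted bipartite degree sequence has a unique canonical decomposition into indecomposable ones. Degree sequences are compared as pairs (primary part, secondary part) of multisets. -}

module Defs where

open import Data.Nat using (ℕ; zero; suc; _+_)
open import Data.Bool using (Bool; if_then_else_)
open import Data.Fin using (Fin)
open import Data.List using (List; []; _∷_; _++_; map; length; allFin)
open import Data.Nat.ListAction using (sum)
open import Data.List.Relation.Binary.Permutation.Propositional using (_↭_)
open import Data.Vec using (Vec; lookup; _∷_; [])
open import Data.Product using (_×_; _,_; Σ; proj₁; proj₂)
open import Relation.Binary.PropositionalEquality using (_≡_)

-- A (candidate) splitted bipartite degree sequence: (primary degrees, secondary degrees).
-- Lists are read as multisets; equality of degree sequences is `_≈ˢ_` below.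
SBDS : Set
SBDS = List ℕ × List ℕ

_≈ˢ_ : SBDS → SBDS → Set
(u , w) ≈ˢ (x , y) = (u ↭ x) × (w ↭ y)

_⊕_ : List ℕ → ℕ → List ℕ
l ⊕ c = map (λ a → a + c) l

_∘ˢ_ : SBDS → SBDS → SBDS
(u , w) ∘ˢ (x , y) = ((u ⊕ length y) ++ x , w ++ (y ⊕ length u))

-- d₁ ∘ d₂ ∘ ⋯ ∘ dₙ for n = suc m ≥ 1 (right-nested; composition is associative)
composeAll : ∀ {m} → Vec SBDS (suc m) → SBDS
composeAll (d ∷ []) = d
composeAll (d ∷ e ∷ ds) = d ∘ˢ composeAll (e ∷ ds)

BipGraph : ℕ → ℕ → Set
BipGraph p q = Fin p → Fin q → Bool

indicator : Bool → ℕ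
indicator b = if b then 1 else 0

degP : ∀ {p q} → BipGraph p q → Fin p → ℕ
degP {q = q} E i = sum (map (λ j → indicator (E i j)) (allFin q))

degS : ∀ {p q} → BipGraph p q → Fin q → ℕ
degS {p = p} E j = sum (map (λ i → indicator (E i j)) (allFin p))

IsSBDS : SBDS → Set
IsSBDS (u , w) =
  Σ (BipGraph (length u) (length w)) λ E →
    ((i : Fin (length u)) → degP E i ≡ Data.List.lookup u i) ×
    ((j : Fin (length w)) → degS E j ≡ Data.List.lookup w j)

IsSBDSOn : ℕ → SBDS → Set
IsSBDSOn k d = IsSBDS d × (length (proj₁ d) ≡ k) × (length (proj₂ d) ≡ k)

-- In a degree sequence on k + k vertices every degree is at most k, so in
-- d ∘ˢ r the primary degrees of d are shifted to at least N, the common bound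
-- on the primary degrees of r (and symmetrically on the secondary side).
-- Applying x ↦ x ⊓ N to a permutation keeps r's part and flattens d's part to
-- copies of N, while x ↦ x ∸ N flattens r's part to zeros and recovers d's
-- part; cancelling the constant blocks shows that composition of such bounded
-- sequences is cancellative, and the factors are peeled off one at a time.
module Submission where

open import Defs
open import Data.Bool using (Bool; true; false)
open import Data.Fin using (Fin; zero; suc)
open import Data.List using (List; []; _∷_; _++_; map; length; replicate; allFin)
open import Data.List.Properties using (length-++; length-map; length-tabulate)
open import Data.List.Relation.Unary.All as All using (All; []; _∷_)
open import Data.List.Relation.Unary.All.Properties using (++⁺; map⁺)
open import Data.List.Relation.Binary.Permutation.Propositional using (_↭_; ↭-trans)
open import Data.List.Relation.Binary.Permutation.Propositional.Properties as ↭
  using (↭-length; drop-∷; ++-comm)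
open import Data.Nat using (ℕ; zero; suc; _≤_; _+_; _*_; _∸_; _⊓_; z≤n; s≤s)
open import Data.Nat.ListAction using (sum)
open import Data.Nat.Properties
open import Data.Product using (Σ; _×_; _,_; proj₁; proj₂)
open import Data.Vec using (Vec; lookup; _∷_; [])
open import Function using (_∘_)
open import Relation.Nullary using (¬_)
open import Relation.Binary.PropositionalEquality

BoundedOn : ℕ → SBDS → Set
BoundedOn k (u , w) = All (_≤ k) u × All (_≤ k) w × length u ≡ k × length w ≡ k

sum-indicator≤length : ∀ {A : Set} (h : A → Bool) (xs : List A) →
  sum (map (λ x → indicator (h x)) xs) ≤ length xs
sum-indicator≤length h [] = z≤n
sum-indicator≤length h (x ∷ xs) with h x
... | true  = s≤s (sum-indicator≤length h xs)
... | false = m≤n⇒m≤1+n (sum-indicator≤length h xs)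

degP≤ : ∀ {p q} (E : BipGraph p q) i → degP E i ≤ q
degP≤ {q = q} E i =
  subst (degP E i ≤_) (length-tabulate (λ j → j)) (sum-indicator≤length (E i) (allFin q))

degS≤ : ∀ {p q} (E : BipGraph p q) j → degS E j ≤ p
degS≤ {p = p} E j =
  subst (degS E j ≤_) (length-tabulate (λ i → i)) (sum-indicator≤length (λ i → E i j) (allFin p))

All-fromLookup : ∀ {A : Set} {P : A → Set} (xs : List A) →
  ((i : Fin (length xs)) → P (Data.List.lookup xs i)) → All P xs
All-fromLookup []       f = []
All-fromLookup (x ∷ xs) f = f zero ∷ All-fromLookup xs (f ∘ suc)

IsSBDSOn⇒BoundedOn : ∀ {k} d → IsSBDSOn k d → BoundedOn k d
IsSBDSOn⇒BoundedOn (u , w) ((E , degU , degW) , refl , lw) =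
  All-fromLookup u (λ i → subst₂ _≤_ (degU i) lw (degP≤ E i)) ,
  All-fromLookup w (λ j → subst (_≤ length u) (degW j) (degS≤ E j)) ,
  refl , lw

∘ˢ-boundedOn : ∀ {a b} d r → BoundedOn a d → BoundedOn b r → BoundedOn (a + b) (d ∘ˢ r)
∘ˢ-boundedOn {a} {b} (u , w) (x , y) (u≤ , w≤ , refl , lw) (x≤ , y≤ , refl , ly) =
  ++⁺ (subst (λ n → All (_≤ a + b) (u ⊕ n)) (sym ly) (map⁺ (All.map (+-monoˡ-≤ b) u≤)))
      (All.map (λ p → ≤-trans p (m≤n+m b a)) x≤) ,
  ++⁺ (All.map (λ p → ≤-trans p (m≤m+n a b)) w≤)
      (map⁺ (All.map (λ {z} p → subst (z + a ≤_) (+-comm b a) (+-monoˡ-≤ a p)) y≤)) ,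
  trans (length-++ (u ⊕ length y)) (cong₂ _+_ (length-map _ u) refl) ,
  trans (length-++ w) (cong₂ _+_ lw (trans (length-map _ y) ly))

composeAll-boundedOn : ∀ {k} m (ds : Vec SBDS (suc m)) →
  ((i : Fin (suc m)) → BoundedOn k (lookup ds i)) → BoundedOn (suc m * k) (composeAll ds)
composeAll-boundedOn {k} zero (d ∷ []) bd = subst (λ n → BoundedOn n d) (sym (+-identityʳ k)) (bd zero)
composeAll-boundedOn (suc m) (d ∷ e ∷ ds) bd =
  ∘ˢ-boundedOn d (composeAll (e ∷ ds)) (bd zero) (composeAll-boundedOn m (e ∷ ds) (bd ∘ suc))

⊓-low++shifted : ∀ {K} {a : List ℕ} → All (_≤ K) a → (b : List ℕ) →
  map (_⊓ K) (a ++ (b ⊕ K)) ≡ a ++ replicate (length b) K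
⊓-low++shifted {K} [] []       = refl
⊓-low++shifted {K} [] (x ∷ b)  = cong₂ _∷_ (m≥n⇒m⊓n≡n (m≤n+m K x)) (⊓-low++shifted [] b)
⊓-low++shifted (p ∷ ps) b      = cong₂ _∷_ (m≤n⇒m⊓n≡m p) (⊓-low++shifted ps b)

∸-low++shifted : ∀ {K} {a : List ℕ} → All (_≤ K) a → (b : List ℕ) →
  map (_∸ K) (a ++ (b ⊕ K)) ≡ replicate (length a) 0 ++ b
∸-low++shifted {K} [] []       = refl
∸-low++shifted {K} [] (x ∷ b)  = cong₂ _∷_ (m+n∸n≡m x K) (∸-low++shifted [] b)
∸-low++shifted (p ∷ ps) b      = cong₂ _∷_ (m≤n⇒m∸n≡0 p) (∸-low++shifted ps b)

↭-cancelˡ : ∀ (zs : List ℕ) {xs ys} → zs ++ xs ↭ zs ++ ys → xs ↭ ys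
↭-cancelˡ []       p = p
↭-cancelˡ (z ∷ zs) p = ↭-cancelˡ zs (drop-∷ p)

↭-cancelʳ : ∀ (zs : List ℕ) {xs ys} → xs ++ zs ↭ ys ++ zs → xs ↭ ys
↭-cancelʳ zs {xs} {ys} p = ↭-cancelˡ zs (↭-trans (++-comm zs xs) (↭-trans p (++-comm ys zs)))

↭-split-shifted : ∀ {K} {a a' : List ℕ} (b b' : List ℕ) → All (_≤ K) a → All (_≤ K) a' →
  length b ≡ length b' → a ++ (b ⊕ K) ↭ a' ++ (b' ⊕ K) → (a ↭ a') × (b ↭ b')
↭-split-shifted {K} {a} {a'} b b' a≤ a'≤ lb p = a↭a' , b↭b'
  where
  a↭a' : a ↭ a'
  a↭a' = ↭-cancelʳ (replicate (length b) K)
    (subst₂ _↭_ (⊓-low++shifted a≤ b)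
                (trans (⊓-low++shifted a'≤ b') (cong (λ n → a' ++ replicate n K) (sym lb)))
                (↭.map⁺ (_⊓ K) p))
  b↭b' : b ↭ b'
  b↭b' = ↭-cancelˡ (replicate (length a) 0)
    (subst₂ _↭_ (∸-low++shifted a≤ b)
                (trans (∸-low++shifted a'≤ b') (cong (λ n → replicate n 0 ++ b') (sym (↭-length a↭a'))))
                (↭.map⁺ (_∸ K) p))

∘ˢ-cancel : ∀ {k N} d f r s → BoundedOn k d → BoundedOn k f → BoundedOn N r → BoundedOn N s →
  (d ∘ˢ r) ≈ˢ (f ∘ˢ s) → (d ≈ˢ f) × (r ≈ˢ s)
∘ˢ-cancel (u , w) (u' , w') (x , y) (x' , y')
  (_ , w≤ , lu , _) (_ , w'≤ , lu' , _) (x≤ , _ , _ , ly) (x'≤ , _ , _ , ly')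
  (primary , secondary) = (proj₂ split₁ , proj₁ split₂) , (proj₁ split₁ , proj₂ split₂)
  where
  split₁ : (x ↭ x') × (u ↭ u')
  split₁ = ↭-split-shifted u u' x≤ x'≤ (trans lu (sym lu'))
    (↭-trans (++-comm x _)
      (↭-trans (subst₂ (λ n n' → (u ⊕ n) ++ x ↭ (u' ⊕ n') ++ x') ly ly' primary) (++-comm _ x')))
  split₂ : (w ↭ w') × (y ↭ y')
  split₂ = ↭-split-shifted y y' w≤ w'≤ (trans ly (sym ly'))
    (subst₂ (λ n n' → w ++ (y ⊕ n) ↭ w' ++ (y' ⊕ n')) lu lu' secondary)

composeAll-injective : ∀ {k} m (ds fs : Vec SBDS (suc m)) →
  ((i : Fin (suc m)) → BoundedOn k (lookup ds i)) →
  ((i : Fin (suc m)) → BoundedOn k (lookup fs i)) →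
  composeAll ds ≈ˢ composeAll fs → (i : Fin (suc m)) → lookup ds i ≈ˢ lookup fs i
composeAll-injective zero (d ∷ []) (f ∷ []) _ _ d≈f zero = d≈f
composeAll-injective (suc m) (d ∷ e ∷ ds) (f ∷ g ∷ fs) bd bf eq = λ where
    zero    → proj₁ heads
    (suc i) → composeAll-injective m (e ∷ ds) (g ∷ fs) (bd ∘ suc) (bf ∘ suc) (proj₂ heads) i
  where
  heads : (d ≈ˢ f) × (composeAll (e ∷ ds) ≈ˢ composeAll (g ∷ fs))
  heads = ∘ˢ-cancel d f (composeAll (e ∷ ds)) (composeAll (g ∷ fs)) (bd zero) (bf zero)
    (composeAll-boundedOn m (e ∷ ds) (bd ∘ suc))
    (composeAll-boundedOn m (g ∷ fs) (bf ∘ suc)) eq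

lemma5p6 : (m k : ℕ) → 1 ≤ k → (ds fs : Vec SBDS (suc m)) →
    ((i : Fin (suc m)) → IsSBDSOn k (lookup ds i)) →
    ((i : Fin (suc m)) → IsSBDSOn k (lookup fs i)) →
    Σ (Fin (suc m)) (λ i → ¬ (lookup ds i ≈ˢ lookup fs i)) →
    ¬ (composeAll ds ≈ˢ composeAll fs)
lemma5p6 m k _ ds fs isD isF (i , dᵢ≉fᵢ) d≈f =
  dᵢ≉fᵢ (composeAll-injective m ds fs
           (λ j → IsSBDSOn⇒BoundedOn (lookup ds j) (isD j))
           (λ j → IsSBDSOn⇒BoundedOn (lookup fs j) (isF j))
           d≈f i)
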